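{- Let $\mathscr{L}$ be a language with semantic structure $\mathcal{S}=(\Sigma,I)$ whose atoms are determined by a partition $P\in\mathrm{Part}(\Sigma)$, i.e. $AP_{\mathscr{L}}=\{p_B\mid B\in P\}$ with $I(p_B)=B$, and suppose $\mathscr{L}$ is closed under infinite logical conjunction. (1) $P_{\mathscr{L}} = \mathrm{pr}(\mathscr{S}_{\boldsymbol{Op}_{\mathscr{L}}}(\mathcal{M}(P)))$. (2) If moreover $\mathscr{L}$ is closed under logical negation, then $\mathrm{par}(P_{\mathscr{L}}) = \mathscr{S}_{\boldsymbol{Op}_{\mathscr{L}}}(\mathcal{M}(P))$.
   Context: A language $\mathscr{L}$: formulas $\varphi::=p\mid f(\varphi_1,\dots,\varphi_n)$, $p\in AP_{\mathscr{L}}$, $f\in Op_{\mathscr{L}}$ finite, arities $>0$; $I(f):\wp(\Sigma)^n\to\wp(\Sigma)$; concrete semantics $[\![\cdot]\!]_{\mathcal{S}}$ defined inductively; $\boldsymbol{Op}_{\mathscr{L}}=\{I(f)\mid f\in Op_{\mathscr{L}}\}$. Closure under infinite logical conjunction: for every $\Phi\subseteq\mathscr{L}$ some $\psi$ has $[\![\psi]\!]_{\mathcal{S}}=\bigcap_{\varphi\in\Phi}[\![\varphi]\!]_{\mathcal{S}}$ ($\bigcap\varnothing=\Sigma$); closure under negation: for every $\varphi$ some $\psi$ has $[\![\psi]\!]_{\mathcal{S}}=\Sigma\setminus[\![\varphi]\!]_{\mathcal{S}}$. $P_{\mathscr{L}}$ is the partition of $\Sigma$ induced by $s\equiv s'\iff\forall\varphi.\,(s\in[\![\varphi]\!]_{\mathcal{S}}\iff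 s'\in[\![\varphi]\!]_{\mathcal{S}})$. Abstract domains of $\wp(\Sigma)_\subseteq$ are Galois insertions $(\alpha,\wp(\Sigma),A,\gamma)$ identified with their closures $\gamma\circ\alpha$ (equivalently, with Moore families: subsets of $\wp(\Sigma)$ closed under arbitrary intersections); $\mathcal{M}(P)$ is the Moore family generated by the blocks of $P$. $\mathrm{par}(P)$: the domain $\wp(P)$ with $\alpha_P(S)=\{B\in P\mid B\cap S\neq\varnothing\}$, $\gamma_P(\mathcal{B})=\bigcup\mathcal{B}$. $\mathrm{pr}(A)$: the partition into classes of $s\equiv_A s'\iff\alpha(\{s\})=\alpha(\{s'\})$. A closure $\mu$ is forward complete for $n$-ary $g$ if $g(\mu(X_1),\dots)=\mu(g(\mu(X_1),\dots))$; $\mathscr{S}_G(A)$ is the most abstract domain refining $A$ (pointwise smaller closure) that is forward complete for all $g\in G$. -}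

module Defs where

open import Level using (0ℓ) renaming (suc to lsuc)
open import Data.Nat using (ℕ; suc)
open import Data.Fin using (Fin)
open import Data.Product using (Σ; ∃; ∃-syntax; _×_; _,_)
open import Relation.Nullary using (¬_)
open import Relation.Binary.PropositionalEquality using (_≡_)
open import Relation.Unary using (Pred; _⊆_)
open import Function.Bundles using (_⇔_)

-- Subsets of a state space St (℘(Σ)) are predicates St → Set.
-- Equality of subsets is extensional equality.

module _ {St : Set} where

  _≐_ : Pred St 0ℓ → Pred St 0ℓ → Set
  X ≐ Y = ∀ s → X s ⇔ Y s

  ⋂ : {I : Set} → (I → Pred St 0ℓ) → Pred St 0ℓ
  ⋂ {I} F s = ∀ (i : I) → F i s

  ｛_｝ : St → Pred St 0ℓ
  ｛ s ｝ t = s ≡ t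

  Family : Set₂
  Family = Pred (Pred St 0ℓ) (lsuc 0ℓ)

  -- Moore family: closed under arbitrary intersections (and, since
  -- subsets are predicates, under extensional equality of subsets).
  record IsMoore (D : Family) : Set₁ where
    field
      resp : ∀ {X Y} → X ≐ Y → D X → D Y
      meet : (I : Set) (F : I → Pred St 0ℓ) → (∀ i → D (F i)) → D (⋂ F)

  mooreClosure : Pred (Pred St 0ℓ) 0ℓ → Family
  mooreClosure A X = Σ Set λ I → Σ (I → Pred St 0ℓ) λ F →
                     (∀ i → A (F i)) × (X ≐ ⋂ F)

  -- The closure operator μ = γ∘α associated with a Moore family D.
  μ : Family → Pred St 0ℓ → Pred St (lsuc 0ℓ)
  μ D X t = ∀ Y → D Y → X ⊆ Y → Y t

  -- pr(A): s ≡_A s' iff α({s}) = α({s'}), i.e. μ({s}) = μ({s'}).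
  pr : Family → St → St → Set₁
  pr D s s' = ∀ t → μ D ｛ s ｝ t ⇔ μ D ｛ s' ｝ t

  -- Forward completeness of (the closure of) D for an n-ary operation g:
  -- g(μ X₁,…,μ Xₙ) is again a fixpoint of μ, i.e. lies in D.
  ForwardComplete : {n : ℕ} → ((Fin n → Pred St 0ℓ) → Pred St 0ℓ) → Family → Set₁
  ForwardComplete g D = ∀ Xs → (∀ i → D (Xs i)) → D (g Xs)

  -- D is S_G(A) for the set of operations G = {g j | j : J}:
  -- the most abstract (= smallest as Moore family) domain refining A
  -- (= containing A) that is forward complete for every g ∈ G.
  record IsShell {J : Set} (ar : J → ℕ)
                 (g : (j : J) → (Fin (ar j) → Pred St 0ℓ) → Pred St 0ℓ)
                 (A : Family) (D : Family) : Set₂ where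
    field
      moore    : IsMoore D
      refines  : ∀ X → A X → D X
      complete : ∀ j → ForwardComplete (g j) D
      greatest : ∀ (D' : Family) → IsMoore D' → (∀ X → A X → D' X) →
                 (∀ j → ForwardComplete (g j) D') → ∀ X → D X → D' X

-- Partitions of St, given by a surjective block-assignment map.

record Partition (St : Set) : Set₁ where
  field
    Block : Set
    blk   : St → Block
    nonempty : ∀ (b : Block) → ∃[ s ] blk s ≡ b

  ⟪_⟫ : Block → Pred St 0ℓ
  ⟪ b ⟫ s = blk s ≡ b

  isBlock : Pred (Pred St 0ℓ) 0ℓ
  isBlock X = ∃[ b ] X ≐ ⟪ b ⟫

  𝓜 : Family
  𝓜 = mooreClosure isBlock

record Language : Set₁ where
  field
    St  : Set
    P   : Partition St
    k   : ℕ
    ar  : Fin k → ℕ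
    ar-pos : ∀ f → ∃[ m ] ar f ≡ suc m
    I   : (f : Fin k) → (Fin (ar f) → Pred St 0ℓ) → Pred St 0ℓ
    -- I(f) is a function on ℘(St)^n, hence respects equality of subsets
    I-resp : ∀ f (Xs Ys : Fin (ar f) → Pred St 0ℓ) →
             (∀ i → Xs i ≐ Ys i) → I f Xs ≐ I f Ys

  open Partition P public

  data Fm : Set where
    atom : Block → Fm
    op   : (f : Fin k) → (Fin (ar f) → Fm) → Fm

  ⟦_⟧ : Fm → Pred St 0ℓ
  ⟦ atom b ⟧    = ⟪ b ⟫
  ⟦ op f φs ⟧ = I f (λ i → ⟦ φs i ⟧)

  ClosedUnderConj : Set₁
  ClosedUnderConj = ∀ (Φ : Pred Fm 0ℓ) →
    ∃[ ψ ] ⟦ ψ ⟧ ≐ (λ s → ∀ φ → Φ φ → ⟦ φ ⟧ s)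

  ClosedUnderNeg : Set
  ClosedUnderNeg = ∀ φ → ∃[ ψ ] ⟦ ψ ⟧ ≐ (λ s → ¬ ⟦ φ ⟧ s)

  -- the equivalence relation whose classes form P_L
  _≡L_ : St → St → Set
  s ≡L s' = ∀ φ → ⟦ φ ⟧ s ⇔ ⟦ φ ⟧ s'

  -- par(P_L) as a Moore family: fixpoints of γ∘α, where
  -- γ(α(X)) = ⋃ {B ∈ P_L | B ∩ X ≠ ∅} = {t | ∃ s ∈ X, s ≡L t}
  parPL : Pred (Pred St 0ℓ) 0ℓ
  parPL X = (λ t → ∃[ s ] (X s × s ≡L t)) ≐ X

  IsS : Family → Set₂
  IsS = IsShell ar I 𝓜

{-# OPTIONS --safe #-}
module Submission where

-- Infinite conjunctions make the definable sets ⟦ φ ⟧ a Moore family; it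
-- contains the blocks of P and is closed under the operators, while every
-- shell of 𝓜 P contains all ⟦ φ ⟧.  So the shell is exactly the family of
-- definable sets, and two states have the same abstraction iff they satisfy
-- the same formulas, which is (1).  With negation, the ≡L-class of s is
-- defined by the conjunction χ s of all formulas true at s, and a union of
-- classes by the negated conjunction of their negations; so every
-- ≡L-saturated set, i.e. every member of par(P_L), is definable, which is (2).

open import Defs
open import Level using (0ℓ; Lift; lift; lower)
open import Data.Product using (Σ; Σ-syntax; ∃-syntax; _×_; _,_; proj₁; proj₂)
open import Data.Unit using (⊤; tt)
open import Function.Base using (_∘_)
open import Function.Bundles using (_⇔_; mk⇔; Equivalence)
import Function.Properties.Equivalence as ⇔
open import Function.Construct.Identity using (⇔-id)
open import Function.Construct.Symmetry using (⇔-sym)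
open import Axiom.ExcludedMiddle using (ExcludedMiddle)
open import Axiom.DoubleNegationElimination
  using (DoubleNegationElimination; em⇒dne)
open import Relation.Nullary using (¬_)
open import Relation.Binary.PropositionalEquality using (_≡_; refl)
open import Relation.Unary using (Pred)

open Equivalence

module _ {St : Set} where

  ≐-refl : {X : Pred St 0ℓ} → X ≐ X
  ≐-refl _ = ⇔-id _

  ≐-sym : {X Y : Pred St 0ℓ} → X ≐ Y → Y ≐ X
  ≐-sym e s = ⇔-sym (e s)

  ≐-trans : {X Y Z : Pred St 0ℓ} → X ≐ Y → Y ≐ Z → X ≐ Z
  ≐-trans e f s = ⇔.trans (e s) (f s)

  ⋂-cong : {I : Set} {F G : I → Pred St 0ℓ} → (∀ i → F i ≐ G i) → ⋂ F ≐ ⋂ G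
  ⋂-cong e s = mk⇔ (λ x i → to (e i s) (x i)) (λ y i → from (e i s) (y i))

  mooreClosure-⊇ : {A : Pred (Pred St 0ℓ) 0ℓ} {X : Pred St 0ℓ} →
                   A X → mooreClosure A X
  mooreClosure-⊇ {X = X} a =
    ⊤ , (λ _ → X) , (λ _ → a) , λ s → mk⇔ (λ x _ → x) (λ x → x tt)

  Indistinguishable : Family {St} → St → St → Set₁
  Indistinguishable D s s' = ∀ Y → D Y → Y s ⇔ Y s'

  pr⇒⊆ : {D : Family {St}} {s s' : St} → pr D s s' → ∀ Y → D Y → Y s → Y s'
  pr⇒⊆ {s' = s'} p Y d y = from (p s') (λ _ _ s'∈ → s'∈ refl) Y d (λ { refl → y })

  pr⇔indistinguishable : (D : Family {St}) (s s' : St) →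
                         pr D s s' ⇔ Indistinguishable D s s'
  pr⇔indistinguishable D s s' = mk⇔
    (λ p Y d → mk⇔ (pr⇒⊆ p Y d) (pr⇒⊆ (λ t → ⇔-sym (p t)) Y d))
    (λ ind t → mk⇔
      (λ m Y d s'⊆Y → m Y d (λ { refl → from (ind Y d) (s'⊆Y refl) }))
      (λ m Y d s⊆Y → m Y d (λ { refl → to (ind Y d) (s⊆Y refl) })))

module _ (L : Language) where
  open Language L

  Definable : Pred (Pred St 0ℓ) 0ℓ
  Definable X = ∃[ ψ ] X ≐ ⟦ ψ ⟧

  ≡L-refl : ∀ {s} → s ≡L s
  ≡L-refl φ = ⇔-id _

  definable-resp-≡L : ∀ {X s s'} → Definable X → s ≡L s' → X s ⇔ X s'
  definable-resp-≡L {s = s} {s'} (ψ , f) e =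
    ⇔.trans (f s) (⇔.trans (e ψ) (⇔-sym (f s')))

  definable⇒parPL : ∀ {X} → Definable X → parPL X
  definable⇒parPL d t = mk⇔
    (λ { (s , x , e) → to (definable-resp-≡L d e) x })
    (λ x → t , x , ≡L-refl)

  module _ {D : Family} (sh : IsS D) where
    open IsShell sh

    ⟦⟧∈shell : ∀ φ → D ⟦ φ ⟧
    ⟦⟧∈shell (atom b)  = refines ⟪ b ⟫ (mooreClosure-⊇ {A = isBlock} (b , ≐-refl))
    ⟦⟧∈shell (op f φs) = complete f (λ i → ⟦ φs i ⟧) (λ i → ⟦⟧∈shell (φs i))

    definable⇒shell : ∀ {X} → Definable X → D X
    definable⇒shell (ψ , e) = IsMoore.resp moore (≐-sym e) (⟦⟧∈shell ψ)

  module _ (cc : ClosedUnderConj) where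

    ⋀ : {I : Set} → (I → Fm) → Fm
    ⋀ F = proj₁ (cc λ φ → ∃[ i ] F i ≡ φ)

    ⟦⋀⟧ : {I : Set} (F : I → Fm) → ⟦ ⋀ F ⟧ ≐ ⋂ (⟦_⟧ ∘ F)
    ⟦⋀⟧ F s = ⇔.trans (proj₂ (cc _) s)
      (mk⇔ (λ h i → h (F i) (i , refl)) (λ { h _ (i , refl) → h i }))

    definable-⋂ : {I : Set} (F : I → Pred St 0ℓ) →
                  (∀ i → Definable (F i)) → Definable (⋂ F)
    definable-⋂ F d =
      ⋀ (proj₁ ∘ d) , ≐-trans (⋂-cong (proj₂ ∘ d)) (≐-sym (⟦⋀⟧ (proj₁ ∘ d)))

    DefinableDomain : Family
    DefinableDomain X = Lift _ (Definable X)

    definableDomain-isMoore : IsMoore DefinableDomain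
    definableDomain-isMoore = record
      { resp = λ { e (lift (ψ , f)) → lift (ψ , ≐-trans (≐-sym e) f) }
      ; meet = λ _ F d → lift (definable-⋂ F (lower ∘ d))
      }

    𝓜⊆definable : ∀ X → 𝓜 X → Definable X
    𝓜⊆definable X (_ , F , blocks , e) with definable-⋂ F (λ i →
      atom (proj₁ (blocks i)) , proj₂ (blocks i))
    ... | ψ , f = ψ , ≐-trans e f

    definableDomain-complete : ∀ f → ForwardComplete (I f) DefinableDomain
    definableDomain-complete f Xs d =
      lift (op f (proj₁ ∘ lower ∘ d) , I-resp f Xs _ (proj₂ ∘ lower ∘ d))

    module _ {D : Family} (sh : IsS D) where

      shell⇒definable : ∀ {X} → D X → Definable X
      shell⇒definable {X} d = lower (IsShell.greatest sh DefinableDomain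
        definableDomain-isMoore (λ X → lift ∘ 𝓜⊆definable X)
        definableDomain-complete X d)

      ≡L⇔indistinguishable : ∀ s s' → s ≡L s' ⇔ Indistinguishable D s s'
      ≡L⇔indistinguishable s s' = mk⇔
        (λ e Y d → definable-resp-≡L (shell⇒definable d) e)
        (λ ind φ → ind ⟦ φ ⟧ (⟦⟧∈shell sh φ))

      ≡L⇔pr : ∀ s s' → s ≡L s' ⇔ pr D s s'
      ≡L⇔pr s s' = ⇔.trans (≡L⇔indistinguishable s s')
                           (⇔-sym (pr⇔indistinguishable D s s'))

    module _ (cn : ClosedUnderNeg) (dne : DoubleNegationElimination 0ℓ) where

      ∼_ : Fm → Fm
      ∼ φ = proj₁ (cn φ)

      ⟦∼⟧ : ∀ φ → ⟦ ∼ φ ⟧ ≐ (¬_ ∘ ⟦ φ ⟧)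
      ⟦∼⟧ φ = proj₂ (cn φ)

      ⋁ : {I : Set} → (I → Fm) → Fm
      ⋁ F = ∼ ⋀ (∼_ ∘ F)

      ⟦⋁⟧ : {I : Set} (F : I → Fm) → ⟦ ⋁ F ⟧ ≐ (λ s → ∃[ i ] ⟦ F i ⟧ s)
      ⟦⋁⟧ F s = mk⇔
        (λ h → dne λ none → to (⟦∼⟧ _ s) h (from (⟦⋀⟧ _ s) λ i →
          from (⟦∼⟧ (F i) s) λ x → none (i , x)))
        (λ { (i , x) → from (⟦∼⟧ _ s) λ c →
          to (⟦∼⟧ (F i) s) (to (⟦⋀⟧ _ s) c i) x })

      χ : St → Fm
      χ s = ⋀ {Σ[ φ ∈ Fm ] ⟦ φ ⟧ s} proj₁

      -- If t satisfied some φ false at s, it would violate ∼ φ, a conjunct of χ s.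
      ⟦χ⟧ : ∀ s → ⟦ χ s ⟧ ≐ (s ≡L_)
      ⟦χ⟧ s t = ⇔.trans (⟦⋀⟧ proj₁ t) (mk⇔
        (λ c φ → mk⇔ (λ x → c (φ , x)) (λ y → dne λ ¬x →
          to (⟦∼⟧ φ t) (c (∼ φ , from (⟦∼⟧ φ s) ¬x)) y))
        (λ { e (φ , x) → to (e φ) x }))

      parPL⇒definable : ∀ {X} → parPL X → Definable X
      parPL⇒definable {X} p = ⋁ {Σ St X} (χ ∘ proj₁) , λ t →
        ⇔.trans (⇔-sym (p t)) (⇔.trans
          (mk⇔ (λ { (s , x , e) → (s , x) , from (⟦χ⟧ s t) e })
               (λ { ((s , x) , c) → s , x , to (⟦χ⟧ s t) c }))
          (⇔-sym (⟦⋁⟧ (χ ∘ proj₁) t)))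

      parPL⇔shell : ∀ {D} → IsS D → ∀ X → parPL X ⇔ D X
      parPL⇔shell sh X = mk⇔ (definable⇒shell sh ∘ parPL⇒definable)
                             (definable⇒parPL ∘ shell⇒definable sh)

corollary6p9 : (L : Language) → let open Language L in
    ClosedUnderConj →
    (∀ (D : Family) → IsS D →
      -- (1) P_L = pr(S_{Op_L}(M(P)))
      (∀ s s' → (s ≡L s') ⇔ pr D s s')
      ×
      -- (2) closed under negation ⇒ par(P_L) = S_{Op_L}(M(P))
      (ClosedUnderNeg → ExcludedMiddle 0ℓ → ∀ X → parPL X ⇔ D X))
corollary6p9 L cc D sh =
  ≡L⇔pr L cc sh , λ cn em → parPL⇔shell L cc cn (em⇒dne em) sh
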